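{- For every integer $n\ge 2$, $h(n)=\lfloor n/4\rfloor+1$. That is, in every rooted binary tree with $n\ge 2$ leaves, at least $\lfloor n/4\rfloor+1$ internal vertices have a child that is a leaf and have an even number of leaf descendants, and there is a rooted binary tree with $n$ leaves in which exactly $\lfloor n/4\rfloor+1$ vertices have this property.
   Context: A rooted binary tree is a rooted tree in which each vertex has either two children or none; vertices with no children are leaves, the others are internal. For a rooted binary tree $T$, let $A(T)$ be the set of internal vertices having a leaf as a neighbor (child). For $x\in A(T)$ let $\psi(x)=1$ if the number of leaves that are descendants of $x$ is even and $\psi(x)=0$ otherwise, and let $\psi_T=\sum_{x\in A(T)}\psi(x)$. For $n\ge 2$, $h(n)=\min\{\psi_T: T \text{ a rooted binary tree with } n \text{ leaves}\}$. -}

module Defs where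

open import Data.Nat using (ℕ; zero; suc; _+_)
open import Data.Nat.Base using (_%_)
open import Data.Bool using (Bool; true; false; _∨_; if_then_else_)

data Tree : Set where
  leaf : Tree
  node : Tree → Tree → Tree

leaves : Tree → ℕ
leaves leaf = 1
leaves (node l r) = leaves l + leaves r

isLeaf : Tree → Bool
isLeaf leaf = true
isLeaf (node _ _) = false

isEven : ℕ → Bool
isEven n with n % 2
... | zero = true
... | suc _ = false

-- ψ(x) for a vertex x (given as the subtree rooted at x), counting 0
-- when x ∉ A(T), i.e. when x is a leaf or has no leaf child.
psiVertex : Tree → ℕ
psiVertex leaf = 0
psiVertex (node l r) =
  if (isLeaf l ∨ isLeaf r) then (if isEven (leaves (node l r)) then 1 else 0) else 0

psiT : Tree → ℕ
psiT leaf = 0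
psiT (node l r) = psiVertex (node l r) + psiT l + psiT r

-- Lower bound: for every internal tree, 4ψ exceeds n + [n even], where n is
-- the number of leaves. This is preserved when a leaf is attached beside a
-- subtree (the new vertex lies in A(T) and counts exactly when the parity of
-- n flips to even) and when two internal trees are joined (the new root is
-- not in A(T), but the two slacks of at least 1 absorb [n even] ≤ 1).
-- Hence ψ > n/4.
--
-- Upper bound: the caterpillar obtained from the three-leaf tree by
-- repeatedly hanging a leaf and a copy of the three-leaf tree on the root has
-- 4k + 3 leaves and ψ = k + 1, since of the two new internal vertices one has
-- no leaf child and the other has an odd number of leaves. Residues 2, 4, 5
-- modulo 4 are reached by small modifications at the root.
module Submission where

open import Data.Bool using (true; false; not; if_then_else_)
open import Data.Bool.Properties using (not-involutive)
open import Data.Nat using (ℕ; zero; suc; _+_; _*_; _/_; _%_; _≤_; _<_; z≤n; s≤s)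
open import Data.Nat.Properties
  using (+-comm; +-assoc; +-suc; +-identityʳ; *-distribʳ-+; ≤-refl; ≤-reflexive; ≤-trans;
         <⇒≤; ≤-<-trans; m≤n⇒m≤1+n; m≤n+m; +-monoˡ-≤; +-mono-≤; module ≤-Reasoning)
open import Data.Nat.DivMod using (m<n*o⇒m/o<n; +-distrib-/-∣ʳ; m*n/n≡m)
open import Data.Nat.Divisibility using (divides-refl)
open import Data.Product using (_×_; Σ; _,_)
open import Relation.Binary.PropositionalEquality
  using (_≡_; refl; sym; trans; cong; cong₂; subst; subst₂; module ≡-Reasoning)

open import Defs

evenIndicator : ℕ → ℕ
evenIndicator n = if isEven n then 1 else 0

evenIndicator≤1 : ∀ n → evenIndicator n ≤ 1
evenIndicator≤1 n with isEven n
... | true  = ≤-refl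
... | false = z≤n

isEven-2+ : ∀ n → isEven (2 + n) ≡ isEven n
isEven-2+ n with n % 2
... | zero  = refl
... | suc _ = refl

isEven-suc : ∀ n → isEven (suc n) ≡ not (isEven n)
isEven-suc zero    = refl
isEven-suc (suc n) = begin
  isEven (2 + n)        ≡⟨ isEven-2+ n ⟩
  isEven n              ≡⟨ not-involutive (isEven n) ⟨
  not (not (isEven n))  ≡⟨ cong not (isEven-suc n) ⟨
  not (isEven (suc n))  ∎
  where open ≡-Reasoning

evenIndicator-2+ : ∀ n → evenIndicator (2 + n) ≡ evenIndicator n
evenIndicator-2+ n = cong (λ b → if b then 1 else 0) (isEven-2+ n)

evenIndicator-+*4 : ∀ r k → evenIndicator (r + k * 4) ≡ evenIndicator r
evenIndicator-+*4 r zero    = cong evenIndicator (+-identityʳ r)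
evenIndicator-+*4 r (suc k) = begin
  evenIndicator (r + (4 + k * 4))  ≡⟨ cong evenIndicator (+-exchange-4 r (k * 4)) ⟩
  evenIndicator (4 + (r + k * 4))  ≡⟨ evenIndicator-2+ (2 + (r + k * 4)) ⟩
  evenIndicator (2 + (r + k * 4))  ≡⟨ evenIndicator-2+ (r + k * 4) ⟩
  evenIndicator (r + k * 4)        ≡⟨ evenIndicator-+*4 r k ⟩
  evenIndicator r                  ∎
  where
  open ≡-Reasoning
  +-exchange-4 : ∀ m n → m + (4 + n) ≡ 4 + (m + n)
  +-exchange-4 m n = trans (sym (+-assoc m 4 n)) (cong (_+ n) (+-comm m 4))

[r+k*4]/4+1 : ∀ r k → (r + k * 4) / 4 + 1 ≡ suc (r / 4 + k)
[r+k*4]/4+1 r k = begin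
  (r + k * 4) / 4 + 1      ≡⟨ cong (_+ 1) (+-distrib-/-∣ʳ r (divides-refl k)) ⟩
  r / 4 + k * 4 / 4 + 1    ≡⟨ cong (λ q → r / 4 + q + 1) (m*n/n≡m k 4) ⟩
  r / 4 + k + 1            ≡⟨ +-comm (r / 4 + k) 1 ⟩
  suc (r / 4 + k)          ∎
  where open ≡-Reasoning

ψ-Bound : Tree → Set
ψ-Bound t = evenIndicator (leaves t) + leaves t < psiT t * 4

psiT-leaf-node : ∀ t → psiT (node leaf t) ≡ evenIndicator (suc (leaves t)) + psiT t
psiT-leaf-node t = cong (_+ psiT t) (+-identityʳ (evenIndicator (suc (leaves t))))

psiT-leaf-mirror : ∀ a b → psiT (node leaf (node a b)) ≡ psiT (node (node a b) leaf)
psiT-leaf-mirror a b = begin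
  evenIndicator (suc n) + 0 + p  ≡⟨ cong (λ m → evenIndicator m + 0 + p) (+-comm 1 n) ⟩
  evenIndicator (n + 1) + 0 + p  ≡⟨ cong (_+ p) (+-identityʳ (evenIndicator (n + 1))) ⟩
  evenIndicator (n + 1) + p      ≡⟨ +-identityʳ _ ⟨
  evenIndicator (n + 1) + p + 0  ∎
  where
  open ≡-Reasoning
  n = leaves (node a b)
  p = psiT (node a b)

ψ-Bound-cherry : ψ-Bound (node leaf leaf)
ψ-Bound-cherry = s≤s (s≤s (s≤s (s≤s z≤n)))

ψ-Bound-leaf-node : ∀ t → ψ-Bound t → ψ-Bound (node leaf t)
ψ-Bound-leaf-node t bound =
  subst (λ p → evenIndicator (suc (leaves t)) + suc (leaves t) < p * 4)
        (sym (psiT-leaf-node t)) (attach bound)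
  where
  attach : ∀ {m p} → evenIndicator m + m < p * 4 →
           evenIndicator (suc m) + suc m < (evenIndicator (suc m) + p) * 4
  attach {m} h rewrite isEven-suc m with isEven m
  ... | true  = h
  ... | false = s≤s (s≤s (s≤s (m≤n⇒m≤1+n (<⇒≤ h))))

ψ-Bound-node-leaf : ∀ a b → ψ-Bound (node a b) → ψ-Bound (node (node a b) leaf)
ψ-Bound-node-leaf a b bound =
  subst₂ (λ n p → evenIndicator n + n < p * 4)
         (+-comm 1 (leaves (node a b))) (psiT-leaf-mirror a b)
         (ψ-Bound-leaf-node (node a b) bound)

ψ-Bound-node-node : ∀ a b c d → ψ-Bound (node a b) → ψ-Bound (node c d) →
                    ψ-Bound (node (node a b) (node c d))
ψ-Bound-node-node a b c d bound₁ bound₂ = begin-strict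
  evenIndicator (m₁ + m₂) + (m₁ + m₂)  ≤⟨ +-monoˡ-≤ (m₁ + m₂) (evenIndicator≤1 (m₁ + m₂)) ⟩
  suc (m₁ + m₂)                        <⟨ s≤s (≤-reflexive (sym (+-suc m₁ m₂))) ⟩
  suc m₁ + suc m₂                      ≤⟨ +-mono-≤ (drop-evenIndicator bound₁) (drop-evenIndicator bound₂) ⟩
  p₁ * 4 + p₂ * 4                      ≡⟨ *-distribʳ-+ 4 p₁ p₂ ⟨
  (p₁ + p₂) * 4                        ∎
  where
  open ≤-Reasoning
  m₁ = leaves (node a b)
  m₂ = leaves (node c d)
  p₁ = psiT (node a b)
  p₂ = psiT (node c d)
  drop-evenIndicator : ∀ {m p} → evenIndicator m + m < p → suc m ≤ p
  drop-evenIndicator {m} = ≤-trans (s≤s (m≤n+m m (evenIndicator m)))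

ψ-Bound-node : ∀ a b → ψ-Bound (node a b)
ψ-Bound-node leaf       leaf       = ψ-Bound-cherry
ψ-Bound-node leaf       (node c d) = ψ-Bound-leaf-node (node c d) (ψ-Bound-node c d)
ψ-Bound-node (node a b) leaf       = ψ-Bound-node-leaf a b (ψ-Bound-node a b)
ψ-Bound-node (node a b) (node c d) =
  ψ-Bound-node-node a b c d (ψ-Bound-node a b) (ψ-Bound-node c d)

leaves/4<psiT : ∀ t → 2 ≤ leaves t → leaves t / 4 < psiT t
leaves/4<psiT leaf       (s≤s ())
leaves/4<psiT (node a b) _ = m<n*o⇒m/o<n (≤-<-trans (m≤n+m n (evenIndicator n)) (ψ-Bound-node a b))
  where n = leaves (node a b)

leaves/4+1≤psiT : ∀ t → 2 ≤ leaves t → leaves t / 4 + 1 ≤ psiT t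
leaves/4+1≤psiT t 2≤n = subst (_≤ psiT t) (+-comm 1 (leaves t / 4)) (leaves/4<psiT t 2≤n)

psiT-node-internal : ∀ s t → isLeaf s ≡ false → isLeaf t ≡ false →
                     psiT (node s t) ≡ psiT s + psiT t
psiT-node-internal (node _ _) (node _ _) _ _ = refl

cherry : Tree
cherry = node leaf leaf

caterpillar : ℕ → Tree
caterpillar zero    = node leaf cherry
caterpillar (suc k) = node leaf (node (caterpillar zero) (caterpillar k))

isLeaf-caterpillar : ∀ k → isLeaf (caterpillar k) ≡ false
isLeaf-caterpillar zero    = refl
isLeaf-caterpillar (suc k) = refl

leaves-caterpillar : ∀ k → leaves (caterpillar k) ≡ 3 + k * 4
leaves-caterpillar zero    = refl
leaves-caterpillar (suc k) = cong (4 +_) (leaves-caterpillar k)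

evenIndicator-+leaves-caterpillar : ∀ r k →
  evenIndicator (r + leaves (caterpillar k)) ≡ evenIndicator (r + 3)
evenIndicator-+leaves-caterpillar r k = begin
  evenIndicator (r + leaves (caterpillar k))  ≡⟨ cong (λ n → evenIndicator (r + n)) (leaves-caterpillar k) ⟩
  evenIndicator (r + (3 + k * 4))             ≡⟨ cong evenIndicator (+-assoc r 3 (k * 4)) ⟨
  evenIndicator (r + 3 + k * 4)               ≡⟨ evenIndicator-+*4 (r + 3) k ⟩
  evenIndicator (r + 3)                       ∎
  where open ≡-Reasoning

psiT-caterpillar : ∀ k → psiT (caterpillar k) ≡ suc k
psiT-caterpillar zero    = refl
psiT-caterpillar (suc k) = begin
  psiT (node leaf spine)                            ≡⟨ psiT-leaf-node spine ⟩
  evenIndicator (4 + leaves (caterpillar k)) + psiT spine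
    ≡⟨ cong₂ _+_ (evenIndicator-+leaves-caterpillar 4 k)
                 (psiT-node-internal (caterpillar zero) (caterpillar k) refl (isLeaf-caterpillar k)) ⟩
  0 + (1 + psiT (caterpillar k))                    ≡⟨ cong suc (psiT-caterpillar k) ⟩
  suc (suc k)                                       ∎
  where
  open ≡-Reasoning
  spine = node (caterpillar zero) (caterpillar k)

data Div4View : ℕ → Set where
  4k+2 : ∀ k → Div4View (2 + k * 4)
  4k+3 : ∀ k → Div4View (3 + k * 4)
  4k+4 : ∀ k → Div4View (4 + k * 4)
  4k+5 : ∀ k → Div4View (5 + k * 4)

div4View : ∀ n → 2 ≤ n → Div4View n
div4View 1 (s≤s ())
div4View 2 _ = 4k+2 0
div4View 3 _ = 4k+3 0
div4View 4 _ = 4k+4 0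
div4View 5 _ = 4k+5 0
div4View (suc (suc (suc (suc (suc (suc n)))))) _ with div4View (2 + n) (s≤s (s≤s z≤n))
... | 4k+2 k = 4k+2 (suc k)
... | 4k+3 k = 4k+3 (suc k)
... | 4k+4 k = 4k+4 (suc k)
... | 4k+5 k = 4k+5 (suc k)

extremal : ∀ {n} → Div4View n → Tree
extremal (4k+2 zero)    = cherry
extremal (4k+2 (suc k)) = node (caterpillar zero) (caterpillar k)
extremal (4k+3 k)       = caterpillar k
extremal (4k+4 k)       = node leaf (caterpillar k)
extremal (4k+5 k)       = node leaf (node leaf (caterpillar k))

leaves-extremal : ∀ {n} (v : Div4View n) → leaves (extremal v) ≡ n
leaves-extremal (4k+2 zero)    = refl
leaves-extremal (4k+2 (suc k)) = cong (3 +_) (leaves-caterpillar k)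
leaves-extremal (4k+3 k)       = leaves-caterpillar k
leaves-extremal (4k+4 k)       = cong (1 +_) (leaves-caterpillar k)
leaves-extremal (4k+5 k)       = cong (2 +_) (leaves-caterpillar k)

psiT-extremal : ∀ {n} (v : Div4View n) → psiT (extremal v) ≡ n / 4 + 1
psiT-extremal (4k+2 zero)    = refl
psiT-extremal (4k+2 (suc k)) = begin
  psiT (node (caterpillar zero) (caterpillar k))
    ≡⟨ psiT-node-internal (caterpillar zero) (caterpillar k) refl (isLeaf-caterpillar k) ⟩
  1 + psiT (caterpillar k)          ≡⟨ cong suc (psiT-caterpillar k) ⟩
  suc (suc k)                       ≡⟨ [r+k*4]/4+1 2 (suc k) ⟨
  (2 + suc k * 4) / 4 + 1           ∎
  where open ≡-Reasoning
psiT-extremal (4k+3 k)       = trans (psiT-caterpillar k) (sym ([r+k*4]/4+1 3 k))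
psiT-extremal (4k+4 k)       = begin
  psiT (node leaf (caterpillar k))  ≡⟨ psiT-leaf-node (caterpillar k) ⟩
  evenIndicator (1 + leaves (caterpillar k)) + psiT (caterpillar k)
    ≡⟨ cong₂ _+_ (evenIndicator-+leaves-caterpillar 1 k) (psiT-caterpillar k) ⟩
  1 + suc k                         ≡⟨ [r+k*4]/4+1 4 k ⟨
  (4 + k * 4) / 4 + 1               ∎
  where open ≡-Reasoning
psiT-extremal (4k+5 k)       = begin
  psiT (node leaf (node leaf (caterpillar k)))  ≡⟨ psiT-leaf-node (node leaf (caterpillar k)) ⟩
  evenIndicator (2 + leaves (caterpillar k)) + psiT (node leaf (caterpillar k))
    ≡⟨ cong₂ _+_ (evenIndicator-+leaves-caterpillar 2 k) (psiT-leaf-node (caterpillar k)) ⟩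
  0 + (evenIndicator (1 + leaves (caterpillar k)) + psiT (caterpillar k))
    ≡⟨ cong₂ _+_ (evenIndicator-+leaves-caterpillar 1 k) (psiT-caterpillar k) ⟩
  1 + suc k                                     ≡⟨ [r+k*4]/4+1 5 k ⟨
  (5 + k * 4) / 4 + 1                           ∎
  where open ≡-Reasoning

mainTheorem4 : (n : ℕ) → 2 ≤ n →
    ((T : Tree) → leaves T ≡ n → n / 4 + 1 ≤ psiT T)
    × Σ Tree (λ T → leaves T ≡ n × psiT T ≡ n / 4 + 1)
mainTheorem4 n 2≤n =
    (λ { T refl → leaves/4+1≤psiT T 2≤n })
  , extremal view , leaves-extremal view , psiT-extremal view
  where view = div4View n 2≤n
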